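{- For $n\geq 4$, $\mathcal{Z}(W_n;x)=\sum_{i=1}^n\big(z(C_{n-1};i-1)+R_3(n-1,i)\big)x^i$.
   Context: $W_n$ (the wheel on $n$ vertices) is obtained from the cycle $C_{n-1}$ by adding a vertex adjacent to all vertices of the cycle. Zero forcing: given a set of colored vertices of a graph, a colored vertex $u$ with exactly one uncolored neighbor $v$ may force $v$, i.e. $v$ becomes colored. A set $S$ of vertices is a zero forcing set if starting with $S$ colored and repeatedly applying this rule eventually colors all vertices. $z(G;i)$ is the number of zero forcing sets of $G$ of size $i$ (so $z(G;0)=0$ for any graph with at least one vertex), and $\mathcal{Z}(G;x)=\sum_{i=1}^{|V(G)|}z(G;i)x^i$. $R_3(N,k)$ denotes the number of $k$-element subsets $S$ of the vertex set of $C_N$ such that the induced subgraph $C_N[S]$ contains a path on $3$ vertices (so $R_3(N,k)=0$ for $k<3$ or $k>N$); for $N>k\geq 3$ it equals $\sum_{t\geq 1}(-1)^{t-1}\frac{N}{t}\binom{N-3t-1}{t-1}\binom{N-4t}{k-3t}$. -}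

module Defs where

open import Data.Nat using (ℕ; zero; suc; _+_; _≡ᵇ_)
open import Data.Nat.DivMod using (_%_)
open import Data.Bool using (Bool; true; false; _∧_; _∨_; not; if_then_else_)
open import Data.Fin using (Fin; zero; suc; toℕ; _≟_)
open import Data.Fin.Subset using (Subset; ∣_∣)
open import Data.List using (List; []; _∷_; _++_; map; filter; length; allFin)
open import Data.Bool.ListAction using (all; any)
open import Data.Bool using (T)
open import Data.Bool.Properties using (T?)
open import Data.Vec using (Vec; lookup) renaming ([] to []ᵛ; _∷_ to _∷ᵛ_)
open import Relation.Nullary.Decidable using (⌊_⌋)
open import Function using (_∘_)

Graph : ℕ → Set
Graph n = Fin n → Fin n → Bool

-- The cycle C_N on vertices 0,…,N-1: i ~ j iff j ≡ i+1 (mod N) or i ≡ j+1 (mod N).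
-- (A genuine simple cycle for N ≥ 3, which is the only case used.)
cycle : (N : ℕ) → Graph N
cycle zero    i j = false
cycle (suc k) i j =
  (toℕ j ≡ᵇ (suc (toℕ i) % suc k)) ∨ (toℕ i ≡ᵇ (suc (toℕ j) % suc k))

-- The wheel W_n on n = suc m vertices: vertex zero is the hub, adjacent to
-- all vertices suc i, which form a copy of the cycle C_m = C_{n-1}.
wheel : (n : ℕ) → Graph n
wheel zero          i       j       = false
wheel (suc m)       zero    zero    = false
wheel (suc m)       zero    (suc j) = true
wheel (suc m)       (suc i) zero    = true
wheel (suc m)       (suc i) (suc j) = cycle m i j

allF : (n : ℕ) → (Fin n → Bool) → Bool
allF n p = all p (allFin n)

anyF : (n : ℕ) → (Fin n → Bool) → Bool
anyF n p = any p (allFin n)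

forces : {n : ℕ} → Graph n → (Fin n → Bool) → Fin n → Fin n → Bool
forces {n} G c u v =
  c u ∧ G u v ∧ not (c v) ∧
  allF n (λ w → not (G u w) ∨ ⌊ w ≟ v ⌋ ∨ c w)

-- One round: perform all currently available forces (forces available at the
-- same time never invalidate each other, so this is a legal sequence of forces).
step : {n : ℕ} → Graph n → (Fin n → Bool) → (Fin n → Bool)
step {n} G c v = c v ∨ anyF n (λ u → forces G c u v)

iter : ℕ → {A : Set} → (A → A) → A → A
iter zero    f a = a
iter (suc k) f a = iter k f (f a)

-- Final colouring obtained from S by applying the rule until no force is
-- possible; each non-final round colours at least one new vertex, so n rounds
-- suffice to reach the (unique) final colouring.
closure : {n : ℕ} → Graph n → Subset n → (Fin n → Bool)
closure {n} G S = iter n (step G) (lookup S)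

isZFS : {n : ℕ} → Graph n → Subset n → Bool
isZFS {n} G S = allF n (closure G S)

allSubsets : (n : ℕ) → List (Subset n)
allSubsets zero    = []ᵛ ∷ []
allSubsets (suc n) = map (true ∷ᵛ_) (allSubsets n) ++ map (false ∷ᵛ_) (allSubsets n)

countSubsets : (n : ℕ) → (Subset n → Bool) → ℕ → ℕ
countSubsets n P i = length (filter (λ S → T? ((∣ S ∣ ≡ᵇ i) ∧ P S)) (allSubsets n))

z : {n : ℕ} → Graph n → ℕ → ℕ
z {n} G i = countSubsets n (isZFS G) i

containsP3 : {n : ℕ} → Graph n → Subset n → Bool
containsP3 {n} G S =
  anyF n (λ b → lookup S b ∧
    anyF n (λ a → anyF n (λ c →
      lookup S a ∧ lookup S c ∧ G b a ∧ G b c ∧ not ⌊ a ≟ c ⌋)))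

R₃ : ℕ → ℕ → ℕ
R₃ N k = countSubsets N (containsP3 (cycle N)) k

module Submission where

open import Defs
open import Data.Nat using (ℕ; suc; _+_; _∸_; _≤_)
open import Relation.Binary.PropositionalEquality using (_≡_)

open import Data.Nat using (zero; _*_; _<_; z≤n; s≤s; _≡ᵇ_)
open import Data.Nat.Properties
  using ( ≡ᵇ⇒≡; ≡⇒≡ᵇ; ≤-refl; ≤-trans; ≤-antisym; <⇒≤; <⇒≢; <⇒≱
        ; +-suc; +-comm; +-assoc; +-cancelʳ-≡; +-monoʳ-≤; m≤m+n; m∸n+n≡m )
open import Data.Nat.DivMod
  using ( _%_; _/_; m%n<n; m%n%n≡m%n; %-distribˡ-+; %-remove-+ˡ; [m+n]%n≡m%n
        ; m<n⇒m%n≡m; m≡m%n+[m/n]*n )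
open import Data.Nat.Divisibility using (∣-refl)
open import Data.Bool using (Bool; true; false; T; _∧_; _∨_; not)
open import Data.Bool.Properties using (T?; T-≡; T-∧; T-∨; ⇔→≡)
open import Data.Fin using (Fin; zero; suc; toℕ; fromℕ<; _≟_)
open import Data.Fin.Properties using (any?; suc-injective; toℕ-injective; toℕ-fromℕ<; toℕ<n)
open import Data.Fin.Subset using (Subset; ∣_∣; _∈_)
open import Data.Fin.Subset.Properties using (p⊂q⇒∣p∣<∣q∣; ∣p∣≤n; ∣p∣≡n⇒p≡⊤; ∈⊤)
open import Data.List using (List; []; _∷_; _++_; map; filter; length; allFin)
open import Data.List.Properties using (filter-++; length-++; filter-≐)
open import Data.List.Membership.Propositional using (lose)
open import Data.List.Membership.Propositional.Properties using (∈-allFin)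
open import Data.List.Relation.Unary.All as All using ()
open import Data.List.Relation.Unary.All.Properties using (all⁺; all⁻)
open import Data.List.Relation.Unary.Any as Any using ()
open import Data.List.Relation.Unary.Any.Properties using (any⁺; any⁻)
open import Data.Vec using (lookup; tabulate) renaming (_∷_ to _∷ᵛ_)
open import Data.Vec.Properties using (lookup∘tabulate; []=⇒lookup; lookup⇒[]=)
open import Data.Vec.Functional using () renaming (_∷_ to _∷ᶜ_)
open import Data.Unit using (tt)
open import Data.Empty using (⊥-elim)
open import Data.Product using (_×_; _,_; proj₁; ∃-syntax)
open import Data.Sum as Sum using (_⊎_; inj₁; inj₂; map₁; map₂)
open import Function using (id; _∘_; _⇔_; mk⇔; Equivalence)
open import Relation.Nullary using (¬_; yes; no; ¬?)
open import Relation.Nullary.Decidable using (⌊_⌋; toWitness; fromWitness; _×-dec_)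
open import Relation.Binary.PropositionalEquality
  using (_≢_; refl; sym; trans; cong; cong₂; subst; module ≡-Reasoning)
open ≡-Reasoning

open Equivalence using (to; from)

-- Write n = m + 1 with hub 0 and rim C_m.  A subset of V(W_n) is a hub bit
-- followed by a rim subset S, so the count splits into the subsets that
-- contain the hub (of rim size i-1) and those that avoid it.  The key tool
-- is a characterisation of zero forcing sets: S is zero forcing iff every
-- closed colouring (one admitting no force) containing S is full.  It holds
-- because a round of forcing is monotone and inflationary, and n rounds
-- reach a stable colouring (each non-stable round colours a new vertex).
-- With it, for the wheel:
--   * hub coloured: closed colourings of W with coloured hub are exactly the
--     closed colourings of the rim, so `true ∷ S` is zero forcing on W iff S
--     is zero forcing on C_m;
--   * hub uncoloured: `false ∷ S` is zero forcing iff C_m[S] contains a P₃;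
--     the centre of a P₃ forces the hub, after which a coloured rim edge
--     spreads around the cycle, while without a P₃ the colouring S itself
--     is closed.
-- The cycle is described through rotations of Fin m (addition modulo m).

T-ext : ∀ {x y} → (T x ⇔ T y) → x ≡ y
T-ext e = ⇔→≡ (mk⇔ (to T-≡ ∘ to e ∘ from T-≡) (to T-≡ ∘ from e ∘ from T-≡))

T-not : ∀ {x} → T (not x) ⇔ (¬ T x)
T-not {true}  = mk⇔ (λ ()) (λ h → h _)
T-not {false} = mk⇔ (λ _ ()) (λ _ → _)

T-implies : ∀ {x y} → T (not x ∨ y) ⇔ (T x → T y)
T-implies {true}  = mk⇔ (λ h _ → h) (λ f → f _)
T-implies {false} = mk⇔ (λ _ ()) (λ _ → _)

allF-reflects : ∀ {n} (p : Fin n → Bool) → T (allF n p) ⇔ (∀ v → T (p v))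
allF-reflects {n} p = mk⇔
  (λ h v → All.lookup (all⁺ p (allFin n) h) (∈-allFin v))
  (λ h → all⁻ p {allFin n} (All.tabulate (λ {v} _ → h v)))

anyF-reflects : ∀ {n} (p : Fin n → Bool) → T (anyF n p) ⇔ (∃[ v ] T (p v))
anyF-reflects {n} p = mk⇔
  (Any.satisfied ∘ any⁻ p (allFin n))
  (λ (v , pv) → any⁺ p (lose (∈-allFin v) pv))

Colouring : ℕ → Set
Colouring n = Fin n → Bool

_⊑_ : ∀ {n} → Colouring n → Colouring n → Set
c ⊑ d = ∀ v → T (c v) → T (d v)

Full : ∀ {n} → Colouring n → Set
Full c = ∀ v → T (c v)

∣_∣ᶜ : ∀ {n} → Colouring n → ℕ
∣ c ∣ᶜ = ∣ tabulate c ∣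

∈-tabulate : ∀ {n} (c : Colouring n) v → v ∈ tabulate c ⇔ T (c v)
∈-tabulate c v = mk⇔
  (λ h → from T-≡ (trans (sym (lookup∘tabulate c v)) ([]=⇒lookup h)))
  (λ h → lookup⇒[]= v (tabulate c) (trans (lookup∘tabulate c v) (to T-≡ h)))

∣∣ᶜ-strict : ∀ {n} {c d : Colouring n} → c ⊑ d → ∀ v → T (d v) → ¬ T (c v) → ∣ c ∣ᶜ < ∣ d ∣ᶜ
∣∣ᶜ-strict {c = c} {d} c⊑d v dv ¬cv = p⊂q⇒∣p∣<∣q∣
  ( (λ {w} w∈c → from (∈-tabulate d w) (c⊑d w (to (∈-tabulate c w) w∈c)))
  , v , from (∈-tabulate d v) dv , ¬cv ∘ to (∈-tabulate c v))

∣∣ᶜ≡n⇒full : ∀ {n} (c : Colouring n) → ∣ c ∣ᶜ ≡ n → Full c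
∣∣ᶜ≡n⇒full c e v = to (∈-tabulate c v) (subst (v ∈_) (sym (∣p∣≡n⇒p≡⊤ e)) ∈⊤)

Forces : ∀ {n} → Graph n → Colouring n → Fin n → Fin n → Set
Forces G c u v =
  T (c u) × T (G u v) × ¬ T (c v) × (∀ w → T (G u w) → w ≡ v ⊎ T (c w))

forces-reflects : ∀ {n} (G : Graph n) c u v → T (forces G c u v) ⇔ Forces G c u v
forces-reflects G c u v = mk⇔ into out
  where
  other : ∀ w → T (not (G u w) ∨ ⌊ w ≟ v ⌋ ∨ c w) ⇔ (T (G u w) → w ≡ v ⊎ T (c w))
  other w = mk⇔
    (λ h g → decode (to T-∨ (to T-implies h g)))
    (λ f → from T-implies (λ g → from T-∨ (encode (f g))))
    where
    decode : T ⌊ w ≟ v ⌋ ⊎ T (c w) → w ≡ v ⊎ T (c w)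
    decode (inj₁ e) = inj₁ (toWitness e)
    decode (inj₂ x) = inj₂ x
    encode : w ≡ v ⊎ T (c w) → T ⌊ w ≟ v ⌋ ⊎ T (c w)
    encode (inj₁ e) = inj₁ (fromWitness e)
    encode (inj₂ x) = inj₂ x
  into : T (forces G c u v) → Forces G c u v
  into h =
    let cu , h₁ = to T-∧ h; guv , h₂ = to T-∧ h₁; ¬cv , h₃ = to T-∧ h₂
    in cu , guv , to T-not ¬cv , λ w → to (other w) (to (allF-reflects _) h₃ w)
  out : Forces G c u v → T (forces G c u v)
  out (cu , guv , ¬cv , rest) = from T-∧ (cu , from T-∧ (guv , from T-∧
    (from T-not ¬cv , from (allF-reflects _) (λ w → from (other w) (rest w)))))

Closed : ∀ {n} → Graph n → Colouring n → Set
Closed G c = ∀ u v → Forces G c u v → T (c v)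

-- A closed colouring missing at most a vertex v that has a neighbour u ≠ v
-- misses nothing: otherwise u would force v.
closed-co-singleton : ∀ {n} {G : Graph n} {d : Colouring n} → Closed G d →
  ∀ {u v} → T (G u v) → u ≢ v → (∀ w → w ≢ v → T (d w)) → T (d v)
closed-co-singleton {d = d} cl {u} {v} guv u≢v elsewhere with T? (d v)
... | yes dv  = dv
... | no  ¬dv = cl u v (elsewhere u u≢v , guv , ¬dv , λ w _ → v-or-coloured w)
  where
  v-or-coloured : ∀ w → w ≡ v ⊎ T (d w)
  v-or-coloured w with w ≟ v
  ... | yes w≡v = inj₁ w≡v
  ... | no  w≢v = inj₂ (elsewhere w w≢v)

module Closure {n : ℕ} (G : Graph n) where

  step-reflects : ∀ c v → T (step G c v) ⇔ (T (c v) ⊎ ∃[ u ] Forces G c u v)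
  step-reflects c v = mk⇔
    (map₂ (λ h → let u , f = to (anyF-reflects _) h in u , to (forces-reflects G c u v) f) ∘ to T-∨)
    (from T-∨ ∘ map₂ (λ (u , f) → from (anyF-reflects _) (u , from (forces-reflects G c u v) f)))

  Stable : Colouring n → Set
  Stable c = step G c ⊑ c

  step-inflationary : ∀ c → c ⊑ step G c
  step-inflationary c v = from (step-reflects c v) ∘ inj₁

  step-monotone : ∀ {c d} → c ⊑ d → step G c ⊑ step G d
  step-monotone {c} {d} c⊑d v h with to (step-reflects c v) h | T? (d v)
  ... | inj₁ cv | _      = from (step-reflects d v) (inj₁ (c⊑d v cv))
  ... | inj₂ _  | yes dv = from (step-reflects d v) (inj₁ dv)
  ... | inj₂ (u , cu , guv , _ , others) | no ¬dv =
    from (step-reflects d v) (inj₂ (u , c⊑d u cu , guv , ¬dv , λ w g → map₂ (c⊑d w) (others w g)))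

  closed⇒stable : ∀ {c} → Closed G c → Stable c
  closed⇒stable {c} cl v h with to (step-reflects c v) h
  ... | inj₁ cv      = cv
  ... | inj₂ (u , f) = cl u v f

  stable⇒closed : ∀ {c} → Stable c → Closed G c
  stable⇒closed {c} st u v f = st v (from (step-reflects c v) (inj₂ (u , f)))

  iterate-below : ∀ k {c d} → c ⊑ d → Stable d → iter k (step G) c ⊑ d
  iterate-below zero    c⊑d st = c⊑d
  iterate-below (suc k) c⊑d st = iterate-below k (λ v → st v ∘ step-monotone c⊑d v) st

  iterate-above : ∀ k c → c ⊑ iter k (step G) c
  iterate-above zero    c v h = h
  iterate-above (suc k) c v h = iterate-above k (step G c) v (step-inflationary c v h)

  stable-iterate : ∀ k {c} → Stable c → Stable (iter k (step G) c)
  stable-iterate zero    st = st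
  stable-iterate (suc k) st = stable-iterate k (step-monotone st)

  stable-or-growing : ∀ c → Stable c ⊎ ∣ c ∣ᶜ < ∣ step G c ∣ᶜ
  stable-or-growing c with any? (λ v → T? (step G c v) ×-dec ¬? (T? (c v)))
  ... | yes (v , new , ¬old) = inj₂ (∣∣ᶜ-strict (step-inflationary c) v new ¬old)
  ... | no none = inj₁ stable
    where
    stable : Stable c
    stable v new with T? (c v)
    ... | yes old  = old
    ... | no  ¬old = ⊥-elim (none (v , new , ¬old))

  iterate-growth : ∀ k c → Stable (iter k (step G) c) ⊎ k + ∣ c ∣ᶜ ≤ ∣ iter k (step G) c ∣ᶜ
  iterate-growth zero    c = inj₂ ≤-refl
  iterate-growth (suc k) c with stable-or-growing c
  ... | inj₁ st = inj₁ (stable-iterate (suc k) st)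
  ... | inj₂ grows with iterate-growth k (step G c)
  ...   | inj₁ st = inj₁ st
  ...   | inj₂ le = inj₂ (≤-trans (subst (_≤ k + ∣ step G c ∣ᶜ) (+-suc k _) (+-monoʳ-≤ k grows)) le)

  -- Since only n vertices can be coloured, n rounds reach a stable colouring.
  iterate-stable : ∀ c → Stable (iter n (step G) c)
  iterate-stable c with iterate-growth n c
  ... | inj₁ st = st
  ... | inj₂ le = λ v _ → ∣∣ᶜ≡n⇒full d (≤-antisym (∣p∣≤n (tabulate d)) (≤-trans (m≤m+n n _) le)) v
    where
    d : Colouring n
    d = iter n (step G) c

  isZFS-reflects : ∀ S → T (isZFS G S) ⇔ (∀ d → Closed G d → lookup S ⊑ d → Full d)
  isZFS-reflects S = mk⇔
    (λ zf d cl S⊑d v → iterate-below n S⊑d (closed⇒stable cl) v (to (allF-reflects _) zf v))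
    (λ H → from (allF-reflects _)
      (H (closure G S) (stable⇒closed (iterate-stable (lookup S))) (iterate-above n (lookup S))))

count : {A : Set} → (A → Bool) → List A → ℕ
count p xs = length (filter (T? ∘ p) xs)

count-++ : {A : Set} (p : A → Bool) (xs ys : List A) → count p (xs ++ ys) ≡ count p xs + count p ys
count-++ p xs ys = trans (cong length (filter-++ (T? ∘ p) xs ys)) (length-++ (filter (T? ∘ p) xs))

count-map : {A B : Set} (p : B → Bool) (g : A → B) (xs : List A) → count p (map g xs) ≡ count (p ∘ g) xs
count-map p g []       = refl
count-map p g (x ∷ xs) with p (g x)
... | true  = cong suc (count-map p g xs)
... | false = count-map p g xs

count-cong : {A : Set} {p q : A → Bool} → (∀ x → p x ≡ q x) → (xs : List A) → count p xs ≡ count q xs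
count-cong {p = p} {q} p≗q xs =
  cong length (filter-≐ (T? ∘ p) (T? ∘ q) ((λ {x} → subst T (p≗q x)) , (λ {x} → subst T (sym (p≗q x)))) xs)

countSubsets-split : ∀ n (P : Subset (suc n) → Bool) i →
  countSubsets (suc n) P (suc i) ≡ countSubsets n (P ∘ (true ∷ᵛ_)) i + countSubsets n (P ∘ (false ∷ᵛ_)) (suc i)
countSubsets-split n P i = begin
  count p (map (true ∷ᵛ_) L ++ map (false ∷ᵛ_) L)         ≡⟨ count-++ p (map (true ∷ᵛ_) L) (map (false ∷ᵛ_) L) ⟩
  count p (map (true ∷ᵛ_) L) + count p (map (false ∷ᵛ_) L) ≡⟨ cong₂ _+_ (count-map p _ L) (count-map p _ L) ⟩
  count (p ∘ (true ∷ᵛ_)) L + count (p ∘ (false ∷ᵛ_)) L     ∎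
  where
  p : Subset (suc n) → Bool
  p S = (∣ S ∣ ≡ᵇ suc i) ∧ P S
  L : List (Subset n)
  L = allSubsets n

countSubsets-cong : ∀ n {P Q : Subset n → Bool} i → (∀ S → P S ≡ Q S) → countSubsets n P i ≡ countSubsets n Q i
countSubsets-cong n i P≗Q = count-cong (λ S → cong ((∣ S ∣ ≡ᵇ i) ∧_) (P≗Q S)) (allSubsets n)

module Rotation (k : ℕ) where

  m : ℕ
  m = suc k

  rot : ℕ → Fin m → Fin m
  rot t a = fromℕ< (m%n<n (t + toℕ a) m)

  toℕ-rot : ∀ t a → toℕ (rot t a) ≡ (t + toℕ a) % m
  toℕ-rot t a = toℕ-fromℕ< _

  +-%-absorb : ∀ s x → (s + x % m) % m ≡ (s + x) % m
  +-%-absorb s x = begin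
    (s + x % m) % m         ≡⟨ %-distribˡ-+ s (x % m) m ⟩
    (s % m + x % m % m) % m ≡⟨ cong (λ y → (s % m + y) % m) (m%n%n≡m%n x m) ⟩
    (s % m + x % m) % m     ≡⟨ %-distribˡ-+ s x m ⟨
    (s + x) % m             ∎

  rot-rot : ∀ s t a → rot s (rot t a) ≡ rot (s + t) a
  rot-rot s t a = toℕ-injective (begin
    toℕ (rot s (rot t a))     ≡⟨ toℕ-rot s (rot t a) ⟩
    (s + toℕ (rot t a)) % m   ≡⟨ cong (λ y → (s + y) % m) (toℕ-rot t a) ⟩
    (s + (t + toℕ a) % m) % m ≡⟨ +-%-absorb s (t + toℕ a) ⟩
    (s + (t + toℕ a)) % m     ≡⟨ cong (_% m) (+-assoc s t (toℕ a)) ⟨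
    (s + t + toℕ a) % m       ≡⟨ toℕ-rot (s + t) a ⟨
    toℕ (rot (s + t) a)       ∎)

  rot-0 : ∀ a → rot 0 a ≡ a
  rot-0 a = toℕ-injective (trans (toℕ-rot 0 a) (m<n⇒m%n≡m (toℕ<n a)))

  rot-m : ∀ a → rot m a ≡ a
  rot-m a = toℕ-injective (begin
    toℕ (rot m a)     ≡⟨ toℕ-rot m a ⟩
    (m + toℕ a) % m   ≡⟨ %-remove-+ˡ (toℕ a) ∣-refl ⟩
    toℕ a % m         ≡⟨ m<n⇒m%n≡m (toℕ<n a) ⟩
    toℕ a             ∎)

  rot-reaches : ∀ a v → ∃[ t ] rot t a ≡ v
  rot-reaches a v = t , toℕ-injective (begin
    toℕ (rot t a)                          ≡⟨ toℕ-rot t a ⟩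
    (toℕ v + (m ∸ toℕ a) + toℕ a) % m     ≡⟨ cong (_% m) (+-assoc (toℕ v) _ (toℕ a)) ⟩
    (toℕ v + (m ∸ toℕ a + toℕ a)) % m     ≡⟨ cong (λ y → (toℕ v + y) % m) (m∸n+n≡m (<⇒≤ (toℕ<n a))) ⟩
    (toℕ v + m) % m                        ≡⟨ [m+n]%n≡m%n (toℕ v) m ⟩
    toℕ v % m                              ≡⟨ m<n⇒m%n≡m (toℕ<n v) ⟩
    toℕ v                                  ∎)
    where
    t : ℕ
    t = toℕ v + (m ∸ toℕ a)

  -- A rotation by 0 < t < m moves every vertex: t would be a multiple of m.
  rot-no-fixpoint : ∀ {t} a → 0 < t → t < m → rot t a ≢ a
  rot-no-fixpoint {t} a 0<t t<m fixed = not-a-multiple ((t + x) / m) t≡q*m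
    where
    x : ℕ
    x = toℕ a
    t≡q*m : t ≡ (t + x) / m * m
    t≡q*m = +-cancelʳ-≡ x t _ (begin
      t + x                         ≡⟨ m≡m%n+[m/n]*n (t + x) m ⟩
      (t + x) % m + (t + x) / m * m ≡⟨ cong (_+ (t + x) / m * m) (trans (sym (toℕ-rot t a)) (cong toℕ fixed)) ⟩
      x + (t + x) / m * m           ≡⟨ +-comm x _ ⟩
      (t + x) / m * m + x           ∎)
    not-a-multiple : ∀ q → t ≢ q * m
    not-a-multiple zero    e = <⇒≢ 0<t (sym e)
    not-a-multiple (suc q) e = <⇒≱ t<m (subst (m ≤_) (sym e) (m≤m+n m (q * m)))

module CycleStructure (k : ℕ) (k≥2 : 2 ≤ k) where

  open Rotation k public

  C : Graph m
  C = cycle m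

  next prev : Fin m → Fin m
  next = rot 1
  prev = rot k

  next-prev : ∀ a → next (prev a) ≡ a
  next-prev a = trans (rot-rot 1 k a) (rot-m a)

  prev-next : ∀ a → prev (next a) ≡ a
  prev-next a = trans (rot-rot k 1 a) (trans (cong (λ t → rot t a) (+-comm k 1)) (rot-m a))

  next-next : ∀ a → next (next a) ≡ rot 2 a
  next-next a = rot-rot 1 1 a

  -- Since m ≥ 3, neither one nor two successor steps return to the start.
  next-≢ : ∀ a → next a ≢ a
  next-≢ a = rot-no-fixpoint a (s≤s z≤n) (s≤s (<⇒≤ k≥2))

  next-next-≢ : ∀ a → next (next a) ≢ a
  next-next-≢ a = rot-no-fixpoint a (s≤s z≤n) (s≤s k≥2) ∘ trans (sym (next-next a))

  next≢prev : ∀ u → next u ≢ prev u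
  next≢prev u e = next-next-≢ u (trans (cong next e) (next-prev u))

  is-next : ∀ i j → T (toℕ j ≡ᵇ suc (toℕ i) % m) ⇔ (j ≡ next i)
  is-next i j = mk⇔
    (λ h → toℕ-injective (trans (≡ᵇ⇒≡ _ _ h) (sym (toℕ-rot 1 i))))
    (λ e → ≡⇒≡ᵇ _ _ (trans (cong toℕ e) (toℕ-rot 1 i)))

  adjacent : ∀ i j → T (C i j) ⇔ (j ≡ next i ⊎ i ≡ next j)
  adjacent i j = mk⇔
    (Sum.map (to (is-next i j)) (to (is-next j i)) ∘ to T-∨)
    (from T-∨ ∘ Sum.map (from (is-next i j)) (from (is-next j i)))

  neighbour : ∀ u w → T (C u w) ⇔ (w ≡ next u ⊎ w ≡ prev u)
  neighbour u w = mk⇔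
    (map₂ (λ e → trans (sym (prev-next w)) (cong prev (sym e))) ∘ to (adjacent u w))
    (from (adjacent u w) ∘ map₂ (λ e → trans (sym (next-prev u)) (cong next (sym e))))

  only-two-neighbours : ∀ {b a c w} → T (C b a) → T (C b c) → a ≢ c → T (C b w) → w ≡ a ⊎ w ≡ c
  only-two-neighbours {b} {a} {c} {w} ba bc a≢c bw
    with to (neighbour b a) ba | to (neighbour b c) bc | to (neighbour b w) bw
  ... | inj₁ refl | inj₁ refl | _         = ⊥-elim (a≢c refl)
  ... | inj₂ refl | inj₂ refl | _         = ⊥-elim (a≢c refl)
  ... | inj₁ refl | _         | inj₁ refl = inj₁ refl
  ... | inj₂ refl | _         | inj₂ refl = inj₁ refl
  ... | _         | inj₁ refl | inj₁ refl = inj₂ refl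
  ... | _         | inj₂ refl | inj₂ refl = inj₂ refl

  Consecutive : Colouring m → Fin m → Set
  Consecutive d a = T (d a) × T (d (next a))

  -- In a closed colouring, a and next a coloured force next (next a):
  -- the only other neighbour of next a is a.
  spread-step : ∀ {d} → Closed C d → ∀ {a} → Consecutive d a → Consecutive d (next a)
  spread-step {d} cl {a} (da , dna) with T? (d (next (next a)))
  ... | yes dnna = dna , dnna
  ... | no ¬dnna = dna , cl (next a) (next (next a))
      (dna , from (neighbour _ _) (inj₁ refl) , ¬dnna , others)
    where
    others : ∀ w → T (C (next a) w) → w ≡ next (next a) ⊎ T (d w)
    others w g = map₂ (λ w≡a → subst (T ∘ d) (sym (trans w≡a (prev-next a))) da) (to (neighbour (next a) w) g)

  consecutive-full : ∀ {d} → Closed C d → ∀ {a} → Consecutive d a → Full d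
  consecutive-full {d} cl {a} start v =
    let t , rot-t≡v = rot-reaches a v in subst (T ∘ d) rot-t≡v (proj₁ (around t))
    where
    around : ∀ t → Consecutive d (rot t a)
    around zero    = subst (Consecutive d) (sym (rot-0 a)) start
    around (suc t) = subst (Consecutive d) (rot-rot 1 t a) (spread-step cl (around t))

  adjacent-full : ∀ {d} → Closed C d → ∀ {a b} → T (C a b) → T (d a) → T (d b) → Full d
  adjacent-full cl {a} {b} ab da db with to (adjacent a b) ab
  ... | inj₁ refl = consecutive-full cl (da , db)
  ... | inj₂ refl = consecutive-full cl (db , da)

record InducedP3 {n} (G : Graph n) (S : Subset n) : Set where
  constructor p3
  field
    centre end₁ end₂ : Fin n
    centre∈S         : T (lookup S centre)
    end₁∈S           : T (lookup S end₁)
    end₂∈S           : T (lookup S end₂)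
    edge₁            : T (G centre end₁)
    edge₂            : T (G centre end₂)
    distinct         : end₁ ≢ end₂

containsP3-reflects : ∀ {n} (G : Graph n) S → T (containsP3 G S) ⇔ InducedP3 G S
containsP3-reflects G S = mk⇔ into out
  where
  into : T (containsP3 G S) → InducedP3 G S
  into h =
    let b , h₁ = to (anyF-reflects _) h; b∈S , h₂ = to T-∧ h₁
        a , h₃ = to (anyF-reflects _) h₂; c , h₄ = to (anyF-reflects _) h₃
        a∈S , h₅ = to T-∧ h₄; c∈S , h₆ = to T-∧ h₅
        ba , h₇ = to T-∧ h₆; bc , a≠c = to T-∧ h₇
    in p3 b a c b∈S a∈S c∈S ba bc (to T-not a≠c ∘ fromWitness)
  out : InducedP3 G S → T (containsP3 G S)
  out (p3 b a c b∈S a∈S c∈S ba bc a≢c) =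
    from (anyF-reflects _) (b , from T-∧ (b∈S , from (anyF-reflects _) (a , from (anyF-reflects _) (c ,
      from T-∧ (a∈S , from T-∧ (c∈S , from T-∧ (ba , from T-∧ (bc , from T-not (a≢c ∘ toWitness)))))))))

module Wheel (k : ℕ) (k≥2 : 2 ≤ k) where

  open CycleStructure k k≥2 public

  W : Graph (suc m)
  W = wheel (suc m)

  rim-closed : ∀ {d} → Closed W d → T (d zero) → Closed C (d ∘ suc)
  rim-closed {d} cl hub u v (du , guv , ¬dv , others) =
    cl (suc u) (suc v) (du , guv , ¬dv , others′)
    where
    others′ : ∀ w → T (W (suc u) w) → w ≡ suc v ⊎ T (d w)
    others′ zero    _ = inj₂ hub
    others′ (suc w) g = map₁ (cong suc) (others w g)

  -- Conversely a closed colouring of the rim, together with the hub, is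
  -- closed on W: the hub can force only when a single rim vertex is
  -- missing, which closedness on the rim excludes.
  hub-extension-closed : ∀ {d} → Closed C d → Closed W (true ∷ᶜ d)
  hub-extension-closed cl u zero _ = tt
  hub-extension-closed {d} cl zero (suc v) (_ , _ , _ , others) =
    closed-co-singleton cl (from (adjacent (next v) v) (inj₂ refl)) (next-≢ v) elsewhere
    where
    elsewhere : ∀ w → w ≢ v → T (d w)
    elsewhere w w≢v = Sum.[ (λ e → ⊥-elim (w≢v (suc-injective e))) , id ] (others (suc w) tt)
  hub-extension-closed {d} cl (suc u) (suc v) (du , guv , ¬dv , others) =
    cl u v (du , guv , ¬dv , λ w g → map₁ suc-injective (others (suc w) g))

  hub-coloured : ∀ S → isZFS W (true ∷ᵛ S) ≡ isZFS C S
  hub-coloured S = T-ext (mk⇔ restrict extend)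
    where
    restrict : T (isZFS W (true ∷ᵛ S)) → T (isZFS C S)
    restrict zf = from (Closure.isZFS-reflects C S) rim-full
      where
      rim-full : ∀ d → Closed C d → lookup S ⊑ d → Full d
      rim-full d cl S⊑d v =
        to (Closure.isZFS-reflects W (true ∷ᵛ S)) zf (true ∷ᶜ d) (hub-extension-closed cl) below (suc v)
        where
        below : lookup (true ∷ᵛ S) ⊑ (true ∷ᶜ d)
        below zero    _ = tt
        below (suc w)   = S⊑d w
    extend : T (isZFS C S) → T (isZFS W (true ∷ᵛ S))
    extend zf = from (Closure.isZFS-reflects W (true ∷ᵛ S)) full
      where
      full : ∀ d → Closed W d → lookup (true ∷ᵛ S) ⊑ d → Full d
      full d cl S⊑d zero    = S⊑d zero tt
      full d cl S⊑d (suc v) =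
        to (Closure.isZFS-reflects C S) zf (d ∘ suc) (rim-closed cl (S⊑d zero tt)) (S⊑d ∘ suc) v

  -- With the hub uncoloured, an induced P3 centred at b lets b force the hub,
  -- after which the rim fills up from the coloured edge b - a.
  P3⇒zfs : ∀ S → InducedP3 C S → T (isZFS W (false ∷ᵛ S))
  P3⇒zfs S (p3 b a c b∈S a∈S c∈S ba bc a≢c) = from (Closure.isZFS-reflects W (false ∷ᵛ S)) full
    where
    full : ∀ d → Closed W d → lookup (false ∷ᵛ S) ⊑ d → Full d
    full d cl S⊑d zero    = hub
      where
      others : ∀ w → T (W (suc b) w) → w ≡ zero ⊎ T (d w)
      others zero    _ = inj₁ refl
      others (suc w) g with only-two-neighbours ba bc a≢c g
      ... | inj₁ refl = inj₂ (S⊑d (suc a) a∈S)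
      ... | inj₂ refl = inj₂ (S⊑d (suc c) c∈S)
      hub : T (d zero)
      hub with T? (d zero)
      ... | yes d₀ = d₀
      ... | no ¬d₀ = cl (suc b) zero (S⊑d (suc b) b∈S , tt , ¬d₀ , others)
    full d cl S⊑d (suc v) =
      adjacent-full (rim-closed cl (full d cl S⊑d zero)) ba (S⊑d (suc b) b∈S) (S⊑d (suc a) a∈S) v

  -- Without an induced P3 the colouring S itself (hub uncoloured) is closed:
  -- the hub is never forced, since a coloured rim vertex u has an
  -- uncoloured rim neighbour, and a rim vertex never forces along the rim,
  -- since its neighbour the hub is uncoloured.
  zfs⇒P3 : ∀ S → T (isZFS W (false ∷ᵛ S)) → InducedP3 C S
  zfs⇒P3 S zf with T? (containsP3 C S)
  ... | yes h  = to (containsP3-reflects C S) h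
  ... | no ¬p3 =
    ⊥-elim (to (Closure.isZFS-reflects W (false ∷ᵛ S)) zf (lookup (false ∷ᵛ S)) closed (λ _ h → h) zero)
    where
    closed : Closed W (lookup (false ∷ᵛ S))
    closed zero    _       (() , _)
    closed (suc u) (suc v) (_ , _ , _ , others) with others zero tt
    ... | inj₁ ()
    ... | inj₂ ()
    closed (suc u) zero    (u∈S , _ , _ , others) = ⊥-elim (¬p3 (from (containsP3-reflects C S)
      (p3 u (next u) (prev u) u∈S (in-S (inj₁ refl)) (in-S (inj₂ refl))
          (from (neighbour u _) (inj₁ refl)) (from (neighbour u _) (inj₂ refl)) (next≢prev u))))
      where
      in-S : ∀ {w} → w ≡ next u ⊎ w ≡ prev u → T (lookup S w)
      in-S {w} nb with others (suc w) (from (neighbour u w) nb)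
      ... | inj₁ ()
      ... | inj₂ w∈S = w∈S

  hub-uncoloured : ∀ S → isZFS W (false ∷ᵛ S) ≡ containsP3 C S
  hub-uncoloured S = T-ext (mk⇔
    (from (containsP3-reflects C S) ∘ zfs⇒P3 S)
    (P3⇒zfs S ∘ to (containsP3-reflects C S)))

  -- The coefficient identity for W_{m+1}: split the subsets by the hub bit
  -- and count each part with the two equivalences above.  (Stated with k
  -- symbolic; for concrete sizes Agda would unfold the subset enumeration.)
  wheel-count : ∀ i → z (wheel (suc (suc k))) (suc i) ≡ z (cycle (suc k)) i + R₃ (suc k) (suc i)
  wheel-count i = trans (countSubsets-split m (isZFS W) i)
    (cong₂ _+_ (countSubsets-cong m i hub-coloured) (countSubsets-cong m (suc i) hub-uncoloured))

theorem4p6 : (n : ℕ) → 4 ≤ n → (i : ℕ) → 1 ≤ i → i ≤ n →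
    z (wheel n) i ≡ z (cycle (n ∸ 1)) (i ∸ 1) + R₃ (n ∸ 1) i
theorem4p6 (suc (suc (suc (suc j)))) (s≤s (s≤s (s≤s (s≤s z≤n)))) (suc i) (s≤s z≤n) _ =
  Wheel.wheel-count (suc (suc j)) (s≤s (s≤s z≤n)) i
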